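{- Let $p, q, r$ be state predicates, let $E$ be a program expression, $ES$ a set-valued program expression and $B$ a Boolean program expression, let $x$ be a program variable, and let $S, T$ be statements whose types make each composite and each correctness assertion below well-typed (with $h$ ranging over state predicates on the appropriate intermediate state space). Then: \[\begin{array}{lcl} \{|p|\}\ \mathsf{abort}\ \{|q, r|\} & \equiv & p = \mathsf{false}\\ \{|p|\}\ \mathsf{stop}\ \{|q, r|\} & \equiv & \mathsf{true}\\ \{|p|\}\ \mathsf{skip}\ \{|q, r|\} & \equiv & p \Rightarrow q\\ \{|p|\}\ \mathsf{raise}\ \{|q, r|\} & \equiv & \mathsf{true}\\ \{|p|\}\ x := E\ \{|q, r|\} & \equiv & \mathsf{def}\,E \wedge p \Rightarrow q[x \backslash \mathsf{val}\,E]\\ \{|p|\}\ x :\in ES\ \{|q, r|\} & \equiv & \mathsf{def}\,ES \wedge p \Rightarrow \forall x' \in \mathsf{val}\,ES \cdot q[x\backslash x']\\ \{|p|\}\ S ; T\ \{|q, r|\} & \equiv & \exists h \cdot \{|p|\}\ S\ \{|h, r|\} \wedge \{h\}\ T\ \{q, p\vee r\}\\ \{|p|\}\ \mathsf{try}\ S\ \mathsf{catch}\ T\ \{|q, r|\} & \equiv & \exists h \cdot \{p\}\ S\ \{q, h\} \wedge \{h\}\ T\ \{q, p \vee r\}\\ \{|p|\}\ S \sqcap T\ \{|q, r|\} & \equiv & \{|p|\}\ S\ \{|q, r|\} \wedge \{|p|\}\ T\ \{|q, r|\}\\ \{|p|\}\ \mathsf{if}\ B\ \mathsf{then}\ S\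 \mathsf{else}\ T\ \{|q, r|\} & \equiv & \{\mathsf{def}\,B \wedge \mathsf{val}\,B \wedge p\}\ S\ \{q, p\vee r\} \wedge \{\mathsf{def}\,B \wedge \neg\mathsf{val}\,B \wedge p\}\ T\ \{q, p\vee r\} \end{array}\] Here, between state predicates, "$u \Rightarrow v$" means the entailment $u \le v$, and $p=\mathsf{false}$ is equality of predicates.
   Context: A state predicate on a state space $\Sigma$ is a function $\Sigma \to Bool$; $\wedge,\vee,\neg,\Rightarrow$ are pointwise, $\mathsf{true},\mathsf{false}$ are constant predicates, and $u \le v$ iff $\forall \sigma.\ u\,\sigma \Rightarrow v\,\sigma$. A relation $\Delta \leftrightarrow \Sigma$ is a function $\Delta \to (\Sigma \to Bool)$. A predicate transformer of type $\mathcal P\Psi \times \mathcal P\Omega \to \mathcal P\Delta$ maps a normal postcondition $q$ on $\Psi$ and an exceptional postcondition $r$ on $\Omega$ to a precondition on $\Delta$; a statement is a monotonic one ($q\le q'$, $r\le r'$ imply $S(q,r)\le S(q',r')$). Definitions: $\mathsf{abort}(q,r)=\mathsf{false}$, $\mathsf{stop}(q,r)=\mathsf{true}$, $\mathsf{skip}(q,r)=q$, $\mathsf{raise}(q,r)=r$, $(S;T)(q,r)=S(T(q,r),r)$, $(S;\!;T)(q,r)=S(q,T(q,r))$, $(S\sqcap T)(q,r)=S(q,r)\wedge T(q,r)$, $\mathsf{try}\ S\ \mathsf{catch}\ T = S;\!;T$. Assumption: $[u,v](q,r) = (u\Rightarrow q)\wedge(v \Rightarrow r)$, $[u](q,r)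 = (u \Rightarrow q)$. Demonic update: $[Q](q,r)\,\delta = \forall\psi.\ Q\,\delta\,\psi \Rightarrow q\,\psi$. A program expression $E$ has a definedness predicate $\mathsf{def}\,E$ and a value $\mathsf{val}\,E$ (total function on states). With state space consisting of variables $x,y$, the relation $x := e$ is $\lambda(x,y).\lambda(x',y').\ x' = e(x,y) \wedge y'=y$ and $x :\in es$ is $\lambda(x,y).\lambda(x',y').\ x' \in es(x,y)\wedge y'=y$. Assignment: $x := E = [\mathsf{def}\,E, \neg\mathsf{def}\,E]; [x := \mathsf{val}\,E]$; $x :\in ES = [\mathsf{def}\,ES,\neg\mathsf{def}\,ES];[x :\in \mathsf{val}\,ES]$. Conditional: $\mathsf{if}\ B\ \mathsf{then}\ S\ \mathsf{else}\ T = [\mathsf{def}\,B,\neg\mathsf{def}\,B];(([\mathsf{val}\,B];S)\sqcap([\neg\mathsf{val}\,B];T))$. $q[x\backslash e]$ denotes substitution of $e$ for $x$ in $q$. Total correctness: $\{p\}\ S\ \{q,r\} \;\widehat=\; p \le S(q,r)$. Partial correctness (defined only when the exceptional state space of $S$ equals its initial state space): $\{|p|\}\ S\ \{|q,r|\} \;\widehat=\; p \le S(q, p \vee r)$. -}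

module Defs where

open import Level using (Level; 0ℓ; _⊔_) renaming (suc to lsuc)
open import Data.Bool using (Bool; T)
open import Data.Product using (_×_; _,_; proj₁; proj₂)
open import Data.Sum using (_⊎_; inj₁; inj₂)
open import Data.Unit using (tt)
open import Relation.Unary using (Pred; _⊆_; _∩_; _∪_; ∁; ∅; U)
open import Relation.Binary.PropositionalEquality using (_≡_)

SPred : Set → Set₁
SPred Σ = Pred Σ 0ℓ

SRel : Set → Set → Set₁
SRel Δ Σ = Δ → SPred Σ

-- Predicate transformers  P Ψ × P Ω → P Δ  (normal post on Ψ, exceptional post on Ω).
PT : Set → Set → Set → Set₁
PT Ψ Ω Δ = SPred Ψ → SPred Ω → SPred Δ

record Stmt (Ψ Ω Δ : Set) : Set₁ where
  constructor stmt
  field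
    tr   : PT Ψ Ω Δ
    mono : ∀ {q q' : SPred Ψ} {r r' : SPred Ω} → q ⊆ q' → r ⊆ r' → tr q r ⊆ tr q' r'
open Stmt public

record Expr {a : Level} (Σ : Set) (V : Set a) : Set (lsuc 0ℓ ⊔ a) where
  field
    def : SPred Σ
    val : Σ → V
open Expr public

_⇒ᵖ_ : ∀ {Σ} → SPred Σ → SPred Σ → SPred Σ
(u ⇒ᵖ v) σ = u σ → v σ

abort : ∀ {Ψ Ω Δ} → Stmt Ψ Ω Δ
abort = stmt (λ q r → ∅) (λ _ _ ())

stop : ∀ {Ψ Ω Δ} → Stmt Ψ Ω Δ
stop = stmt (λ q r → U) (λ _ _ _ → tt)

skip : ∀ {Ω Δ} → Stmt Δ Ω Δ
skip = stmt (λ q r → q) (λ qq _ x → qq x)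

raise : ∀ {Ψ Δ} → Stmt Ψ Δ Δ
raise = stmt (λ q r → r) (λ _ rr x → rr x)

_⨾_ : ∀ {Φ Ψ Ω Δ} → Stmt Φ Ω Δ → Stmt Ψ Ω Φ → Stmt Ψ Ω Δ
S ⨾ T = stmt (λ q r → tr S (tr T q r) r)
             (λ qq rr → mono S (mono T qq rr) rr)

_⨾⨾_ : ∀ {Ψ Φ Ω Δ} → Stmt Ψ Φ Δ → Stmt Ψ Ω Φ → Stmt Ψ Ω Δ
S ⨾⨾ T = stmt (λ q r → tr S q (tr T q r))
              (λ qq rr → mono S qq (mono T qq rr))

_⊓_ : ∀ {Ψ Ω Δ} → Stmt Ψ Ω Δ → Stmt Ψ Ω Δ → Stmt Ψ Ω Δ
S ⊓ T = stmt (λ q r → tr S q r ∩ tr T q r)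
             (λ qq rr (a , b) → mono S qq rr a , mono T qq rr b)

try_catch_ : ∀ {Ψ Φ Ω Δ} → Stmt Ψ Φ Δ → Stmt Ψ Ω Φ → Stmt Ψ Ω Δ
try S catch T = S ⨾⨾ T

assume₂ : ∀ {Δ} → SPred Δ → SPred Δ → Stmt Δ Δ Δ
assume₂ u v = stmt (λ q r → (u ⇒ᵖ q) ∩ (v ⇒ᵖ r))
                   (λ qq rr (a , b) → (λ x → qq (a x)) , (λ x → rr (b x)))

assume : ∀ {Ω Δ} → SPred Δ → Stmt Δ Ω Δ
assume u = stmt (λ q r → u ⇒ᵖ q) (λ qq _ a x → qq (a x))

demonic : ∀ {Ω Δ Σ} → SRel Δ Σ → Stmt Σ Ω Δ
demonic Q = stmt (λ q r δ → ∀ ψ → Q δ ψ → q ψ) (λ qq _ a ψ h → qq (a ψ h))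

-- Relations  x := e  and  x :∈ es  on the state space X × Y (x the variable, y the rest)
assignRel : ∀ {X Y : Set} → (X × Y → X) → SRel (X × Y) (X × Y)
assignRel e (x , y) (x' , y') = (x' ≡ e (x , y)) × (y' ≡ y)

chooseRel : ∀ {X Y : Set} → (X × Y → SPred X) → SRel (X × Y) (X × Y)
chooseRel es (x , y) (x' , y') = es (x , y) x' × (y' ≡ y)

assign : ∀ {X Y : Set} → Expr (X × Y) X → Stmt (X × Y) (X × Y) (X × Y)
assign E = assume₂ (def E) (∁ (def E)) ⨾ demonic (assignRel (val E))

choose : ∀ {X Y : Set} → Expr (X × Y) (SPred X) → Stmt (X × Y) (X × Y) (X × Y)
choose ES = assume₂ (def ES) (∁ (def ES)) ⨾ demonic (chooseRel (val ES))

valP : ∀ {Δ} → Expr Δ Bool → SPred Δ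
valP B σ = T (val B σ)

if_then_else_ : ∀ {Ψ Δ} → Expr Δ Bool → Stmt Ψ Δ Δ → Stmt Ψ Δ Δ → Stmt Ψ Δ Δ
if B then S else T =
  assume₂ (def B) (∁ (def B)) ⨾ ((assume (valP B) ⨾ S) ⊓ (assume (∁ (valP B)) ⨾ T))

_[x≔_] : ∀ {X Y : Set} → SPred (X × Y) → (X × Y → X) → SPred (X × Y)
(q [x≔ e ]) (x , y) = q (e (x , y) , y)

⟪_⟫_⟪_,_⟫ : ∀ {Ψ Ω Δ} → SPred Δ → Stmt Ψ Ω Δ → SPred Ψ → SPred Ω → Set
⟪ p ⟫ S ⟪ q , r ⟫ = p ⊆ tr S q r

⟅_⟆_⟅_,_⟆ : ∀ {Ψ Δ} → SPred Δ → Stmt Ψ Δ Δ → SPred Ψ → SPred Δ → Set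
⟅ p ⟆ S ⟅ q , r ⟆ = p ⊆ tr S q (p ∪ r)

-- Partial correctness is total correctness with exceptional postcondition p ∪ r, so
-- ⟅ p ⟆ S ⟅ q , r ⟆ and ⟪ p ⟫ S ⟪ q , p ∪ r ⟫ are the same type.  Every rule is therefore
-- an instance of a total-correctness rule for the corresponding constructor.  For the
-- composites, monotonicity lets the intermediate predicate be chosen as the weakest one,
-- T(q, p ∪ r).  The guard [def E, ¬ def E] of assignments and conditionals contributes
-- only the exceptional obligation ¬ def E ∩ p ⊆ p ∪ r, which partial correctness
-- discharges for free.
module Submission where

open import Defs
open import Data.Bool using (Bool)
open import Data.Product using (Σ; _×_; _,_; proj₁; proj₂)
open import Data.Product.Function.NonDependent.Propositional using (_×-⇔_)
open import Data.Sum using (inj₁)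
open import Data.Unit using (⊤; tt)
open import Function using (const)
open import Function.Bundles using (_⇔_; mk⇔)
open import Function.Properties.Equivalence using () renaming (refl to ⇔-refl; trans to ⇔-trans)
open import Relation.Binary.PropositionalEquality using (refl)
open import Relation.Unary using (_⊆_; _∩_; _∪_; ∁; ∅; _≐_)

private
  variable
    Φ Ψ Ω Δ X Y : Set

inhabited⇔⊤ : {A : Set} → A → A ⇔ ⊤
inhabited⇔⊤ a = mk⇔ (const tt) (const a)

⊆-congˡ-≐ : {P Q R : SPred Δ} → P ≐ Q → (P ⊆ R) ⇔ (Q ⊆ R)
⊆-congˡ-≐ (P⊆Q , Q⊆P) = mk⇔ (λ P⊆R {δ} Q∋δ → P⊆R (Q⊆P Q∋δ)) (λ Q⊆R {δ} P∋δ → Q⊆R (P⊆Q P∋δ))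

⊆-congʳ-≐ : {P Q R : SPred Δ} → Q ≐ R → (P ⊆ Q) ⇔ (P ⊆ R)
⊆-congʳ-≐ (Q⊆R , R⊆Q) = mk⇔ (λ P⊆Q {δ} P∋δ → Q⊆R (P⊆Q P∋δ)) (λ P⊆R {δ} P∋δ → R⊆Q (P⊆R P∋δ))

∩-swap : (P Q R : SPred Δ) → P ∩ (Q ∩ R) ≐ Q ∩ (P ∩ R)
∩-swap P Q R = (λ (p , q , r) → q , p , r) , (λ (q , p , r) → p , q , r)

abort-correct : (p : SPred Δ) (q : SPred Ψ) (r : SPred Ω) → (⟪ p ⟫ abort ⟪ q , r ⟫) ⇔ (p ≐ ∅)
abort-correct p q r = mk⇔ (λ p⊆∅ → p⊆∅ , λ ()) proj₁

⨾-correct : (S : Stmt Φ Ω Δ) (T : Stmt Ψ Ω Φ) (p : SPred Δ) (q : SPred Ψ) (r : SPred Ω) →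
            (⟪ p ⟫ S ⨾ T ⟪ q , r ⟫)
              ⇔ Σ (SPred Φ) (λ h → (⟪ p ⟫ S ⟪ h , r ⟫) × (⟪ h ⟫ T ⟪ q , r ⟫))
⨾-correct S T p q r = mk⇔
  (λ p⊆ST → tr T q r , p⊆ST , λ {δ} h∋δ → h∋δ)
  (λ (h , p⊆Sh , h⊆T) {δ} p∋δ → mono S h⊆T (λ {δ} x → x) (p⊆Sh p∋δ))

⨾⨾-correct : (S : Stmt Ψ Φ Δ) (T : Stmt Ψ Ω Φ) (p : SPred Δ) (q : SPred Ψ) (r : SPred Ω) →
             (⟪ p ⟫ S ⨾⨾ T ⟪ q , r ⟫)
               ⇔ Σ (SPred Φ) (λ h → (⟪ p ⟫ S ⟪ q , h ⟫) × (⟪ h ⟫ T ⟪ q , r ⟫))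
⨾⨾-correct S T p q r = mk⇔
  (λ p⊆ST → tr T q r , p⊆ST , λ {δ} h∋δ → h∋δ)
  (λ (h , p⊆Sh , h⊆T) {δ} p∋δ → mono S (λ {δ} x → x) h⊆T (p⊆Sh p∋δ))

⊓-correct : (S T : Stmt Ψ Ω Δ) (p : SPred Δ) (q : SPred Ψ) (r : SPred Ω) →
            (⟪ p ⟫ S ⊓ T ⟪ q , r ⟫) ⇔ ((⟪ p ⟫ S ⟪ q , r ⟫) × (⟪ p ⟫ T ⟪ q , r ⟫))
⊓-correct S T p q r = mk⇔
  (λ p⊆S⊓T → (λ {δ} p∋δ → proj₁ (p⊆S⊓T p∋δ)) , (λ {δ} p∋δ → proj₂ (p⊆S⊓T p∋δ)))
  (λ (p⊆S , p⊆T) {δ} p∋δ → p⊆S p∋δ , p⊆T p∋δ)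

assume-⨾-correct : (u : SPred Δ) (S : Stmt Ψ Ω Δ) (p : SPred Δ) (q : SPred Ψ) (r : SPred Ω) →
                   (⟪ p ⟫ assume u ⨾ S ⟪ q , r ⟫) ⇔ (⟪ u ∩ p ⟫ S ⟪ q , r ⟫)
assume-⨾-correct u S p q r = mk⇔
  (λ p⊆uS {δ} (u∋δ , p∋δ) → p⊆uS p∋δ u∋δ)
  (λ up⊆S {δ} p∋δ u∋δ → up⊆S (u∋δ , p∋δ))

assume₂-⨾-correct : (u v : SPred Δ) (S : Stmt Ψ Δ Δ) (p : SPred Δ) (q : SPred Ψ) (r : SPred Δ) →
                    (⟪ p ⟫ assume₂ u v ⨾ S ⟪ q , r ⟫) ⇔ ((⟪ u ∩ p ⟫ S ⟪ q , r ⟫) × (v ∩ p ⊆ r))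
assume₂-⨾-correct u v S p q r = mk⇔
  (λ p⊆uvS → (λ {δ} (u∋δ , p∋δ) → proj₁ (p⊆uvS p∋δ) u∋δ)
           , (λ {δ} (v∋δ , p∋δ) → proj₂ (p⊆uvS p∋δ) v∋δ))
  (λ (up⊆S , vp⊆r) {δ} p∋δ → (λ u∋δ → up⊆S (u∋δ , p∋δ)) , (λ v∋δ → vp⊆r (v∋δ , p∋δ)))

guarded-partial : (u : SPred Δ) (S : Stmt Ψ Δ Δ) (p : SPred Δ) (q : SPred Ψ) (r : SPred Δ) →
                  (⟅ p ⟆ assume₂ u (∁ u) ⨾ S ⟅ q , r ⟆) ⇔ (⟪ u ∩ p ⟫ S ⟪ q , p ∪ r ⟫)
guarded-partial u S p q r = ⇔-trans
  (assume₂-⨾-correct u (∁ u) S p q (p ∪ r))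
  (mk⇔ proj₁ (λ up⊆S → up⊆S , λ {δ} (_ , p∋δ) → inj₁ p∋δ))

branches : SPred Δ → Stmt Ψ Ω Δ → Stmt Ψ Ω Δ → Stmt Ψ Ω Δ
branches b S T = (assume b ⨾ S) ⊓ (assume (∁ b) ⨾ T)

branches-correct : (b : SPred Δ) (S T : Stmt Ψ Ω Δ) (p : SPred Δ) (q : SPred Ψ) (r : SPred Ω) →
                   (⟪ p ⟫ branches b S T ⟪ q , r ⟫)
                     ⇔ ((⟪ b ∩ p ⟫ S ⟪ q , r ⟫) × (⟪ ∁ b ∩ p ⟫ T ⟪ q , r ⟫))
branches-correct b S T p q r = ⇔-trans
  (⊓-correct (assume b ⨾ S) (assume (∁ b) ⨾ T) p q r)
  (assume-⨾-correct b S p q r ×-⇔ assume-⨾-correct (∁ b) T p q r)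

assign-wp : (e : X × Y → X) (q : SPred (X × Y)) (r : SPred Ω) →
            tr (demonic (assignRel e)) q r ≐ q [x≔ e ]
assign-wp e q r =
  (λ { {x , y} wp → wp (e (x , y) , y) (refl , refl) })
  , (λ { {x , y} q∋e (_ , _) (refl , refl) → q∋e })

choose-wp : (es : X × Y → SPred X) (q : SPred (X × Y)) (r : SPred Ω) →
            tr (demonic (chooseRel es)) q r ≐ (λ σ → ∀ x' → es σ x' → q (x' , proj₂ σ))
choose-wp es q r =
  (λ { {x , y} wp x' x'∈es → wp (x' , y) (x'∈es , refl) })
  , (λ { {x , y} q∋es (x' , _) (x'∈es , refl) → q∋es x' x'∈es })

theorem3 : (∀ {Ψ Δ : Set} (p : SPred Δ) (q : SPred Ψ) (r : SPred Δ) →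
    (⟅ p ⟆ abort ⟅ q , r ⟆) ⇔ (p ≐ ∅))
    ×
    (∀ {Ψ Δ : Set} (p : SPred Δ) (q : SPred Ψ) (r : SPred Δ) →
    (⟅ p ⟆ stop ⟅ q , r ⟆) ⇔ ⊤)
    ×
    (∀ {Δ : Set} (p q r : SPred Δ) →
    (⟅ p ⟆ skip ⟅ q , r ⟆) ⇔ (p ⊆ q))
    ×
    (∀ {Ψ Δ : Set} (p : SPred Δ) (q : SPred Ψ) (r : SPred Δ) →
    (⟅ p ⟆ raise ⟅ q , r ⟆) ⇔ ⊤)
    ×
    (∀ {X Y : Set} (E : Expr (X × Y) X) (p q r : SPred (X × Y)) →
    (⟅ p ⟆ assign E ⟅ q , r ⟆) ⇔ ((def E ∩ p) ⊆ (q [x≔ val E ])))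
    ×
    (∀ {X Y : Set} (ES : Expr (X × Y) (SPred X)) (p q r : SPred (X × Y)) →
    (⟅ p ⟆ choose ES ⟅ q , r ⟆)
    ⇔ ((def ES ∩ p) ⊆ (λ σ → ∀ x' → val ES σ x' → q (x' , proj₂ σ))))
    ×
    (∀ {Φ Ψ Δ : Set} (S : Stmt Φ Δ Δ) (T : Stmt Ψ Δ Φ)
    (p : SPred Δ) (q : SPred Ψ) (r : SPred Δ) →
    (⟅ p ⟆ (S ⨾ T) ⟅ q , r ⟆)
    ⇔ Σ (SPred Φ) (λ h → (⟅ p ⟆ S ⟅ h , r ⟆) × (⟪ h ⟫ T ⟪ q , p ∪ r ⟫)))
    ×
    (∀ {Ψ Φ Δ : Set} (S : Stmt Ψ Φ Δ) (T : Stmt Ψ Δ Φ)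
    (p : SPred Δ) (q : SPred Ψ) (r : SPred Δ) →
    (⟅ p ⟆ (try S catch T) ⟅ q , r ⟆)
    ⇔ Σ (SPred Φ) (λ h → (⟪ p ⟫ S ⟪ q , h ⟫) × (⟪ h ⟫ T ⟪ q , p ∪ r ⟫)))
    ×
    (∀ {Ψ Δ : Set} (S T : Stmt Ψ Δ Δ) (p : SPred Δ) (q : SPred Ψ) (r : SPred Δ) →
    (⟅ p ⟆ (S ⊓ T) ⟅ q , r ⟆) ⇔ ((⟅ p ⟆ S ⟅ q , r ⟆) × (⟅ p ⟆ T ⟅ q , r ⟆)))
    ×
    (∀ {Ψ Δ : Set} (B : Expr Δ Bool) (S T : Stmt Ψ Δ Δ)
    (p : SPred Δ) (q : SPred Ψ) (r : SPred Δ) →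
    (⟅ p ⟆ (if B then S else T) ⟅ q , r ⟆)
    ⇔ ((⟪ def B ∩ (valP B ∩ p) ⟫ S ⟪ q , p ∪ r ⟫)
    × (⟪ def B ∩ (∁ (valP B) ∩ p) ⟫ T ⟪ q , p ∪ r ⟫)))
theorem3 =
    (λ p q r → abort-correct p q (p ∪ r))
  , (λ p q r → inhabited⇔⊤ (λ {δ} _ → tt))
  , (λ p q r → ⇔-refl)
  , (λ p q r → inhabited⇔⊤ (λ {δ} → inj₁))
  , (λ E p q r → ⇔-trans (guarded-partial (def E) (demonic (assignRel (val E))) p q r)
                         (⊆-congʳ-≐ (assign-wp (val E) q (p ∪ r))))
  , (λ ES p q r → ⇔-trans (guarded-partial (def ES) (demonic (chooseRel (val ES))) p q r)
                          (⊆-congʳ-≐ (choose-wp (val ES) q (p ∪ r))))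
  , (λ S T p q r → ⨾-correct S T p q (p ∪ r))
  , (λ S T p q r → ⨾⨾-correct S T p q (p ∪ r))
  , (λ S T p q r → ⊓-correct S T p q (p ∪ r))
  , (λ B S T p q r → ⇔-trans (guarded-partial (def B) (branches (valP B) S T) p q r)
      (⇔-trans (branches-correct (valP B) S T (def B ∩ p) q (p ∪ r))
               (⊆-congˡ-≐ (∩-swap (valP B) (def B) p) ×-⇔ ⊆-congˡ-≐ (∩-swap (∁ (valP B)) (def B) p))))
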